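{- $\mathrm{PL}(=\!(\cdot))$ is bicomplete for $\{(\mathcal{P},\mathcal{Q}) \mid \mathcal{P},\mathcal{Q}$ are downward closed and have the empty team property, and $\mathcal{P},\mathcal{Q}$ are ground-complementary / ground-complementary modulo $\bot\wedge\mathrm{NE}$ / world-incompatible$\}$, and hence bicomplete modulo expressive power for pairs which are ground-complementary / ground-complementary modulo $\bot\wedge\mathrm{NE}$ / world-incompatible.
   Context: Propositional dependence logic $\mathrm{PL}(=\!(\cdot))$: $\phi ::= p \mid \bot \mid \neg\phi \mid \phi\wedge\phi \mid \phi\vee\phi \mid {=}\!(p_1,\ldots,p_n,q)$, on propositional teams with support $\models$ / anti-support $\models^-$: $p$ supported iff all $w\in s$ make $p$ true, anti-supported iff none do; $s\models\bot$ iff $s=\emptyset$, $\bot$ always anti-supported; $s\models{=}\!(p_1,\ldots,p_n,q)$ iff any $v,w\in s$ agreeing on all $p_i$ agree on $q$, anti-supported iff $s=\emptyset$; $\neg$ swaps support and anti-support; $\wedge$ supported iff both are, anti-supported iff $s=t\cup u$ with $t\models^-\phi,u\models^-\psi$; $\vee$ supported iff $s=t\cup u$ with $t\models\phi,u\models\psi$, anti-supported iff both are. Team properties over finite $\mathsf{X}$ are sets of teams $s\subseteq 2^\mathsf{X}$; $\|\phi\|_\mathsf{X}$ is the set of teams supporting $\phi$. For properties: ground-complementary means $\bigcup\mathcal{P}=2^\mathsf{X}\setminus\bigcup\mathcal{Q}$; modulo $\bot\wedge\mathrm{NE}$ additionally allows $\mathcal{P}=\emptyset$ or $\mathcal{Q}=\emptyset$;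 world-incompatible means for every valuation $w$, $\{w\}\in\mathcal{P}$ iff $\{w\}\notin\mathcal{Q}$ (these coincide for downward closed properties with the empty team property). $L$ is bicomplete for a class $\mathscr{P}$ of pairs if for every finite $\mathsf{X}$, $\{(\|\phi\|_\mathsf{X},\|\neg\phi\|_\mathsf{X})\mid\phi\in L\}$ equals the pairs of $\mathscr{P}$ over $\mathsf{X}$; bicomplete modulo expressive power if bicomplete for $\mathscr{P}$ restricted to pairs of properties expressible in $L$. -}

module Defs where

open import Data.Nat using (ℕ)
open import Data.Fin using (Fin)
open import Data.Bool using (Bool; true; false; _∨_; _≟_)
open import Data.Vec using (Vec; lookup)
open import Data.Vec.Properties using (≡-dec)
open import Data.List using (List)
open import Data.List.Relation.Unary.All using (All)
open import Data.Product using (Σ; ∃; _×_)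
open import Data.Sum using (_⊎_)
open import Data.Empty using (⊥)
open import Data.Unit using (⊤)
open import Relation.Nullary using (¬_; does)
open import Relation.Binary.PropositionalEquality using (_≡_)
open import Function.Bundles using (_⇔_)

-- The finite set X of propositional symbols is Fin n.
-- A valuation w ∈ 2^X.
Val : ℕ → Set
Val n = Vec Bool n

-- A team is a subset of 2^X, given by its (decidable) characteristic function.
Team : ℕ → Set
Team n = Val n → Bool

-- A team property is a set of teams (decidable membership; X is finite).
TeamProp : ℕ → Set
TeamProp n = Team n → Bool

emptyTeam : ∀ {n} → Team n
emptyTeam _ = false

singleton : ∀ {n} → Val n → Team n
singleton w v = does (≡-dec _≟_ v w)

_⊆ₜ_ : ∀ {n} → Team n → Team n → Set
t ⊆ₜ s = ∀ w → t w ≡ true → s w ≡ true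

IsUnion : ∀ {n} → Team n → Team n → Team n → Set
IsUnion s t u = ∀ w → s w ≡ (t w ∨ u w)

data Form (n : ℕ) : Set where
  var  : Fin n → Form n
  bot  : Form n
  ~_   : Form n → Form n
  _∧'_ : Form n → Form n → Form n
  _∨'_ : Form n → Form n → Form n
  dep  : List (Fin n) → Fin n → Form n

mutual
  _⊨_ : ∀ {n} → Team n → Form n → Set
  s ⊨ var p = ∀ w → s w ≡ true → lookup w p ≡ true
  s ⊨ bot = ∀ w → s w ≡ false
  s ⊨ (~ φ) = s ⊨⁻ φ
  s ⊨ (φ ∧' ψ) = (s ⊨ φ) × (s ⊨ ψ)
  s ⊨ (φ ∨' ψ) = Σ (Team _) λ t → Σ (Team _) λ u → IsUnion s t u × (t ⊨ φ) × (u ⊨ ψ)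
  s ⊨ dep ps q = ∀ v w → s v ≡ true → s w ≡ true →
                 All (λ p → lookup v p ≡ lookup w p) ps → lookup v q ≡ lookup w q

  _⊨⁻_ : ∀ {n} → Team n → Form n → Set
  s ⊨⁻ var p = ∀ w → s w ≡ true → lookup w p ≡ false
  s ⊨⁻ bot = ⊤
  s ⊨⁻ (~ φ) = s ⊨ φ
  s ⊨⁻ (φ ∧' ψ) = Σ (Team _) λ t → Σ (Team _) λ u → IsUnion s t u × (t ⊨⁻ φ) × (u ⊨⁻ ψ)
  s ⊨⁻ (φ ∨' ψ) = (s ⊨⁻ φ) × (s ⊨⁻ ψ)
  s ⊨⁻ dep ps q = ∀ w → s w ≡ false

Expresses : ∀ {n} → Form n → TeamProp n → Set
Expresses φ P = ∀ s → (s ⊨ φ) ⇔ (P s ≡ true)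

ExpressesPair : ∀ {n} → Form n → TeamProp n → TeamProp n → Set
ExpressesPair φ P Q = Expresses φ P × Expresses (~ φ) Q

Expressible : ∀ {n} → TeamProp n → Set
Expressible P = ∃ λ φ → Expresses φ P

DownwardClosed : ∀ {n} → TeamProp n → Set
DownwardClosed P = ∀ s t → t ⊆ₜ s → P s ≡ true → P t ≡ true

EmptyTeamProperty : ∀ {n} → TeamProp n → Set
EmptyTeamProperty P = P emptyTeam ≡ true

InBigUnion : ∀ {n} → TeamProp n → Val n → Set
InBigUnion P w = ∃ λ s → P s ≡ true × s w ≡ true

IsEmptyProp : ∀ {n} → TeamProp n → Set
IsEmptyProp P = ∀ s → P s ≡ false

GroundComplementary : ∀ {n} → TeamProp n → TeamProp n → Set
GroundComplementary P Q = ∀ w → InBigUnion P w ⇔ (¬ InBigUnion Q w)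

GroundComplementaryModBotNE : ∀ {n} → TeamProp n → TeamProp n → Set
GroundComplementaryModBotNE P Q = GroundComplementary P Q ⊎ IsEmptyProp P ⊎ IsEmptyProp Q

WorldIncompatible : ∀ {n} → TeamProp n → TeamProp n → Set
WorldIncompatible P Q = ∀ w → (singleton w ∈P) ⇔ (¬ (Q (singleton w) ≡ true))
  where _∈P : Team _ → Set
        s ∈P = P s ≡ true

Bicomplete : (∀ {n} → TeamProp n → TeamProp n → Set) → Set
Bicomplete C = ∀ n (P Q : TeamProp n) → (∃ λ φ → ExpressesPair φ P Q) ⇔ C P Q

BicompleteModExpr : (∀ {n} → TeamProp n → TeamProp n → Set) → Set
BicompleteModExpr C = ∀ n (P Q : TeamProp n) → Expressible P → Expressible Q →
  (∃ λ φ → ExpressesPair φ P Q) ⇔ C P Q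

DCE : (∀ {n} → TeamProp n → TeamProp n → Set) → ∀ {n} → TeamProp n → TeamProp n → Set
DCE C P Q = DownwardClosed P × EmptyTeamProperty P × DownwardClosed Q × EmptyTeamProperty Q × C P Q

{-# OPTIONS --safe #-}
-- Soundness: ‖φ‖ and ‖¬φ‖ are downward closed with the empty team property, and on a singleton
-- team exactly one of φ, ¬φ is supported, so the pair is world-incompatible; for downward closed
-- properties world-incompatibility and ground-complementarity coincide.
--
-- Completeness: a downward closed P with the empty team property is expressed by its characteristic
-- formula α_P, the conjunction over the finitely many teams S ∉ P of a formula saying S ⊄ s, namely
-- "s ∖ S lies outside S and s ∩ S has at most |S| - 1 elements" (at most k elements: a k-fold
-- disjunction of ⋀ᵢ =(pᵢ)).
--
-- For a world-incompatible pair (P, Q) let A = {w | {w} ∈ P} and χ_A the flat formula for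
-- "contained in A". Then (α_P ∧ χ_A) ∨ ¬(α_Q ∨ χ_A) has support P and anti-support Q: by
-- world-incompatibility the worlds outside A are exactly those whose singleton is in Q, which
-- forces the ¬(α_Q ∨ χ_A)-part of a supporting team, and the χ_A-part of an anti-supporting
-- team, to be empty.
module Submission where

open import Defs
open import Data.Nat using (ℕ; zero; suc; pred; _≤_; z≤n; s≤s)
open import Data.Nat.Properties using (≤-trans; m≤n⇒m≤1+n; 1+n≰n)
open import Data.Fin using (Fin)
open import Data.Bool using (Bool; true; false; _∧_; _∨_; not)
import Data.Bool as Bool
open import Data.Bool.Properties using (¬-not; not-¬; not-involutive; ∨-identityʳ; ∨-idem; ∨-zeroʳ)
open import Data.Vec using ([]; _∷_; lookup)
open import Data.Vec.Properties using (≡-dec; ∷-injectiveʳ)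
open import Data.Vec.Relation.Binary.Pointwise.Extensional using (ext; Pointwise-≡⇒≡)
open import Data.List using (List; []; _∷_; [_]; map; _++_; length; filter; allFin)
open import Data.List.Properties using (length-removeAt; length-removeAt′)
open import Data.List.Relation.Unary.Any as Any using (Any; here; there; any?)
open import Data.List.Relation.Unary.All as All using ([])
open import Data.List.Relation.Unary.AllPairs using ([]; _∷_)
open import Data.List.Relation.Unary.Unique.Propositional using (Unique)
import Data.List.Relation.Unary.Unique.Propositional.Properties as Unique
open import Data.List.Relation.Binary.Subset.Propositional using (_⊆_)
open import Data.List.Membership.Propositional using (_∈_; _─_; find; lose)
open import Data.List.Membership.Propositional.Properties
  using (∈-map⁺; ∈-map⁻; ∈-++⁺ˡ; ∈-++⁺ʳ; ∈-filter⁺; ∈-filter⁻; ∈-allFin)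
open import Data.Product using (∃; _×_; _,_; proj₂)
open import Data.Sum using (_⊎_; inj₁; inj₂; [_,_]′; swap)
open import Data.Unit using (tt)
open import Data.Empty using (⊥; ⊥-elim)
open import Function using (id; _∘_; case_of_)
open import Function.Bundles using (_⇔_; mk⇔; Equivalence)
import Function.Properties.Equivalence as ⇔
open import Relation.Nullary using (Dec; yes; no; does; ¬_; contradiction)
open import Relation.Nullary.Decidable using (dec-true)
import Relation.Nullary.Decidable as Dec
open import Relation.Unary using (Decidable)
open import Relation.Binary.PropositionalEquality using (_≡_; _≢_; refl; sym; trans; cong; subst)

private
  variable
    n : ℕ
    A : Set
    s t u a b : Team n
    v w : Val n
    φ ψ : Form n

_∈ₜ_ : Val n → Team n → Set
w ∈ₜ s = s w ≡ true

_∉ₜ_ : Val n → Team n → Set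
w ∉ₜ s = s w ≡ false

_∩_ : Team n → Team n → Team n
(s ∩ t) w = s w ∧ t w

∁ : Team n → Team n
∁ a w = not (a w)

_≟ᵥ_ : (v w : Val n) → Dec (v ≡ w)
_≟ᵥ_ = ≡-dec Bool._≟_

does⇒ : {P : Set} (p? : Dec P) → does p? ≡ true → P
does⇒ (yes p) _ = p

∨-true⁻ : ∀ a b → a ∨ b ≡ true → a ≡ true ⊎ b ≡ true
∨-true⁻ true  _ _ = inj₁ refl
∨-true⁻ false _ e = inj₂ e

∈-∪⁻ : ∀ (t u : Team n) → IsUnion s t u → ∀ w → w ∈ₜ s → w ∈ₜ t ⊎ w ∈ₜ u
∈-∪⁻ t u s≡t∪u w w∈s = ∨-true⁻ (t w) (u w) (trans (sym (s≡t∪u w)) w∈s)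

∈-∪⁻ˡ : ∀ (t u : Team n) → IsUnion s t u → ∀ w → w ∈ₜ s → ¬ w ∈ₜ u → w ∈ₜ t
∈-∪⁻ˡ t u s≡t∪u w w∈s w∉u = [ id , ⊥-elim ∘ w∉u ]′ (∈-∪⁻ t u s≡t∪u w w∈s)

∪-⊆ˡ : IsUnion s t u → t ⊆ₜ s
∪-⊆ˡ s≡t∪u w w∈t = trans (s≡t∪u w) (cong (_∨ _) w∈t)

∪-⊆ʳ : IsUnion s t u → u ⊆ₜ s
∪-⊆ʳ {t = t} s≡t∪u w w∈u = trans (s≡t∪u w) (trans (cong (t w ∨_) w∈u) (∨-zeroʳ (t w)))

∪-identityˡ : IsUnion s emptyTeam s
∪-identityˡ _ = refl

∪-identityʳ : IsUnion s s emptyTeam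
∪-identityʳ {s = s} w = sym (∨-identityʳ (s w))

∪-idem : IsUnion s s s
∪-idem {s = s} w = sym (∨-idem (s w))

∩-∁-partition : ∀ (s a : Team n) → IsUnion s (s ∩ a) (s ∩ ∁ a)
∩-∁-partition s a w with s w | a w
... | true  | true  = refl
... | true  | false = refl
... | false | _     = refl

∩-distrib-∪ : t ⊆ₜ s → IsUnion s a b → IsUnion t (t ∩ a) (t ∩ b)
∩-distrib-∪ {t = t} t⊆s s≡a∪b w with t w in w∈t
... | true  = trans (sym (t⊆s w w∈t)) (s≡a∪b w)
... | false = refl

∩-⊆ˡ : ∀ (s a : Team n) → (s ∩ a) ⊆ₜ s
∩-⊆ˡ s a w w∈s∩a with s w
... | true = refl

∩-⊆ʳ : ∀ (s a : Team n) → (s ∩ a) ⊆ₜ a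
∩-⊆ʳ s a w w∈s∩a with s w
... | true = w∈s∩a

∈-∁⁻ : ∀ (a : Team n) w → w ∈ₜ ∁ a → w ∉ₜ a
∈-∁⁻ a w w∈∁a with a w
... | false = refl

∈-singleton : ∀ w → w ∈ₜ singleton {n} w
∈-singleton w = dec-true (w ≟ᵥ w) refl

∈-singleton⁻ : ∀ v w → v ∈ₜ singleton {n} w → v ≡ w
∈-singleton⁻ v w = does⇒ (v ≟ᵥ w)

singleton-⊆ : w ∈ₜ s → singleton w ⊆ₜ s
singleton-⊆ {s = s} w∈s v v∈[w] = subst (_∈ₜ s) (sym (∈-singleton⁻ v _ v∈[w])) w∈s

-- Basic properties of support and anti-support

mutual
  ⊨-downward : ∀ (φ : Form n) → t ⊆ₜ s → s ⊨ φ → t ⊨ φ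
  ⊨-downward (var p)    t⊆s h w w∈t = h w (t⊆s w w∈t)
  ⊨-downward bot        t⊆s h w     = ¬-not (λ w∈t → not-¬ (t⊆s w w∈t) (h w))
  ⊨-downward (~ φ)      t⊆s h       = ⊨⁻-downward φ t⊆s h
  ⊨-downward (φ ∧' ψ)   t⊆s (hφ , hψ) = ⊨-downward φ t⊆s hφ , ⊨-downward ψ t⊆s hψ
  ⊨-downward {t = t} (φ ∨' ψ) t⊆s (a , b , s≡a∪b , ha , hb) =
    t ∩ a , t ∩ b , ∩-distrib-∪ t⊆s s≡a∪b , ⊨-downward φ (∩-⊆ʳ t a) ha , ⊨-downward ψ (∩-⊆ʳ t b) hb
  ⊨-downward (dep ps q) t⊆s h v w v∈t w∈t = h v w (t⊆s v v∈t) (t⊆s w w∈t)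

  ⊨⁻-downward : ∀ (φ : Form n) → t ⊆ₜ s → s ⊨⁻ φ → t ⊨⁻ φ
  ⊨⁻-downward (var p)    t⊆s h w w∈t = h w (t⊆s w w∈t)
  ⊨⁻-downward bot        t⊆s h       = tt
  ⊨⁻-downward (~ φ)      t⊆s h       = ⊨-downward φ t⊆s h
  ⊨⁻-downward {t = t} (φ ∧' ψ) t⊆s (a , b , s≡a∪b , ha , hb) =
    t ∩ a , t ∩ b , ∩-distrib-∪ t⊆s s≡a∪b , ⊨⁻-downward φ (∩-⊆ʳ t a) ha , ⊨⁻-downward ψ (∩-⊆ʳ t b) hb
  ⊨⁻-downward (φ ∨' ψ)   t⊆s (hφ , hψ) = ⊨⁻-downward φ t⊆s hφ , ⊨⁻-downward ψ t⊆s hψ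
  ⊨⁻-downward (dep ps q) t⊆s h w     = ¬-not (λ w∈t → not-¬ (t⊆s w w∈t) (h w))

mutual
  ∅-⊨ : ∀ (φ : Form n) → emptyTeam ⊨ φ
  ∅-⊨ (var p)    w ()
  ∅-⊨ bot        w = refl
  ∅-⊨ (~ φ)        = ∅-⊨⁻ φ
  ∅-⊨ (φ ∧' ψ)     = ∅-⊨ φ , ∅-⊨ ψ
  ∅-⊨ (φ ∨' ψ)     = emptyTeam , emptyTeam , ∪-idem , ∅-⊨ φ , ∅-⊨ ψ
  ∅-⊨ (dep ps q) v w ()

  ∅-⊨⁻ : ∀ (φ : Form n) → emptyTeam ⊨⁻ φ
  ∅-⊨⁻ (var p)    w ()
  ∅-⊨⁻ bot          = tt
  ∅-⊨⁻ (~ φ)        = ∅-⊨ φ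
  ∅-⊨⁻ (φ ∧' ψ)     = emptyTeam , emptyTeam , ∪-idem , ∅-⊨⁻ φ , ∅-⊨⁻ ψ
  ∅-⊨⁻ (φ ∨' ψ)     = ∅-⊨⁻ φ , ∅-⊨⁻ ψ
  ∅-⊨⁻ (dep ps q) w = refl

⊨-∨-introˡ : ∀ φ ψ → s ⊨ φ → s ⊨ (φ ∨' ψ)
⊨-∨-introˡ {s = s} φ ψ h = s , emptyTeam , ∪-identityʳ , h , ∅-⊨ ψ

⊨-∨-introʳ : ∀ φ ψ → s ⊨ ψ → s ⊨ (φ ∨' ψ)
⊨-∨-introʳ {s = s} φ ψ h = emptyTeam , s , ∪-identityˡ , ∅-⊨ φ , h

⊨⁻-∧-introˡ : ∀ φ ψ → s ⊨⁻ φ → s ⊨⁻ (φ ∧' ψ)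
⊨⁻-∧-introˡ {s = s} φ ψ h = s , emptyTeam , ∪-identityʳ , h , ∅-⊨⁻ ψ

⊨⁻-∧-introʳ : ∀ φ ψ → s ⊨⁻ ψ → s ⊨⁻ (φ ∧' ψ)
⊨⁻-∧-introʳ {s = s} φ ψ h = emptyTeam , s , ∪-identityˡ , ∅-⊨⁻ φ , h

⊨-⊨⁻-disjoint : ∀ (φ : Form n) w → w ∈ₜ s → s ⊨ φ → s ⊨⁻ φ → ⊥
⊨-⊨⁻-disjoint (var p)    w w∈s h h′ = not-¬ (h w w∈s) (h′ w w∈s)
⊨-⊨⁻-disjoint bot        w w∈s h h′ = not-¬ w∈s (h w)
⊨-⊨⁻-disjoint (~ φ)      w w∈s h h′ = ⊨-⊨⁻-disjoint φ w w∈s h′ h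
⊨-⊨⁻-disjoint (φ ∧' ψ)   w w∈s (hφ , hψ) (a , b , s≡a∪b , h′φ , h′ψ) =
  [ (λ w∈a → ⊨-⊨⁻-disjoint φ w w∈a (⊨-downward φ (∪-⊆ˡ s≡a∪b) hφ) h′φ)
  , (λ w∈b → ⊨-⊨⁻-disjoint ψ w w∈b (⊨-downward ψ (∪-⊆ʳ s≡a∪b) hψ) h′ψ) ]′ (∈-∪⁻ a b s≡a∪b w w∈s)
⊨-⊨⁻-disjoint (φ ∨' ψ)   w w∈s (a , b , s≡a∪b , hφ , hψ) (h′φ , h′ψ) =
  [ (λ w∈a → ⊨-⊨⁻-disjoint φ w w∈a hφ (⊨⁻-downward φ (∪-⊆ˡ s≡a∪b) h′φ))
  , (λ w∈b → ⊨-⊨⁻-disjoint ψ w w∈b hψ (⊨⁻-downward ψ (∪-⊆ʳ s≡a∪b) h′ψ)) ]′ (∈-∪⁻ a b s≡a∪b w w∈s)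
⊨-⊨⁻-disjoint (dep ps q) w w∈s h h′ = not-¬ w∈s (h′ w)

singleton-⊨⊎⊨⁻ : ∀ (φ : Form n) (w : Val n) → singleton w ⊨ φ ⊎ singleton w ⊨⁻ φ
singleton-⊨⊎⊨⁻ (var p) w with lookup w p in wₚ
... | true  = inj₁ (λ v v∈[w] → trans (cong (λ x → lookup x p) (∈-singleton⁻ v w v∈[w])) wₚ)
... | false = inj₂ (λ v v∈[w] → trans (cong (λ x → lookup x p) (∈-singleton⁻ v w v∈[w])) wₚ)
singleton-⊨⊎⊨⁻ bot      w = inj₂ tt
singleton-⊨⊎⊨⁻ (~ φ)    w = swap (singleton-⊨⊎⊨⁻ φ w)
singleton-⊨⊎⊨⁻ (φ ∧' ψ) w with singleton-⊨⊎⊨⁻ φ w | singleton-⊨⊎⊨⁻ ψ w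
... | inj₁ hφ | inj₁ hψ = inj₁ (hφ , hψ)
... | inj₂ hφ | _       = inj₂ (⊨⁻-∧-introˡ φ ψ hφ)
... | inj₁ _  | inj₂ hψ = inj₂ (⊨⁻-∧-introʳ φ ψ hψ)
singleton-⊨⊎⊨⁻ (φ ∨' ψ) w with singleton-⊨⊎⊨⁻ φ w | singleton-⊨⊎⊨⁻ ψ w
... | inj₂ hφ | inj₂ hψ = inj₂ (hφ , hψ)
... | inj₁ hφ | _       = inj₁ (⊨-∨-introˡ φ ψ hφ)
... | inj₂ _  | inj₁ hψ = inj₁ (⊨-∨-introʳ φ ψ hψ)
singleton-⊨⊎⊨⁻ (dep ps q) w = inj₁ (λ u v u∈[w] v∈[w] _ →
  cong (λ x → lookup x q) (trans (∈-singleton⁻ u w u∈[w]) (sym (∈-singleton⁻ v w v∈[w]))))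

⊨⁻⇒singleton-⊭ : ∀ (φ : Form n) → s ⊨⁻ φ → w ∈ₜ s → ¬ singleton w ⊨ φ
⊨⁻⇒singleton-⊭ {w = w} φ h w∈s h′ =
  ⊨-⊨⁻-disjoint φ w (∈-singleton w) h′ (⊨⁻-downward φ (singleton-⊆ w∈s) h)

expresses⇒downwardClosed : ∀ (φ : Form n) {P} → Expresses φ P → DownwardClosed P
expresses⇒downwardClosed φ φ≡P s t t⊆s Ps =
  Equivalence.to (φ≡P t) (⊨-downward φ t⊆s (Equivalence.from (φ≡P s) Ps))

expresses⇒emptyTeamProperty : ∀ (φ : Form n) {P} → Expresses φ P → EmptyTeamProperty P
expresses⇒emptyTeamProperty φ φ≡P = Equivalence.to (φ≡P emptyTeam) (∅-⊨ φ)

expressesPair⇒worldIncompatible : ∀ (φ : Form n) {P Q} → ExpressesPair φ P Q → WorldIncompatible P Q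
expressesPair⇒worldIncompatible φ (φ≡P , ¬φ≡Q) w = mk⇔
  (λ P[w] Q[w] → ⊨-⊨⁻-disjoint φ w (∈-singleton w)
                   (Equivalence.from (φ≡P _) P[w]) (Equivalence.from (¬φ≡Q _) Q[w]))
  (λ ¬Q[w] → case singleton-⊨⊎⊨⁻ φ w of λ where
    (inj₁ h) → Equivalence.to (φ≡P _) h
    (inj₂ h) → contradiction (Equivalence.to (¬φ≡Q _) h) ¬Q[w])

expressesPair⇒DCE : ∀ (φ : Form n) {P Q} → ExpressesPair φ P Q → DCE WorldIncompatible P Q
expressesPair⇒DCE φ φ≡PQ@(φ≡P , ¬φ≡Q) =
  expresses⇒downwardClosed φ φ≡P , expresses⇒emptyTeamProperty φ φ≡P ,
  expresses⇒downwardClosed (~ φ) ¬φ≡Q , expresses⇒emptyTeamProperty (~ φ) ¬φ≡Q ,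
  expressesPair⇒worldIncompatible φ φ≡PQ

groundComplementary⇔worldIncompatible : ∀ {P Q : TeamProp n} → DownwardClosed P → DownwardClosed Q →
                                        GroundComplementary P Q ⇔ WorldIncompatible P Q
groundComplementary⇔worldIncompatible {P = P} {Q} dcP dcQ = mk⇔ gc⇒wi wi⇒gc
  where
  gc⇒wi : GroundComplementary P Q → WorldIncompatible P Q
  gc⇒wi gc w = mk⇔
    (λ P[w] Q[w] → Equivalence.to (gc w) (_ , P[w] , ∈-singleton w) (_ , Q[w] , ∈-singleton w))
    (λ ¬Q[w] → let (s , Ps , w∈s) = Equivalence.from (gc w) (λ (s , Qs , w∈s) →
                                        ¬Q[w] (dcQ s _ (singleton-⊆ w∈s) Qs))
               in dcP s _ (singleton-⊆ w∈s) Ps)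

  wi⇒gc : WorldIncompatible P Q → GroundComplementary P Q
  wi⇒gc wi w = mk⇔
    (λ (s , Ps , w∈s) (t , Qt , w∈t) →
       Equivalence.to (wi w) (dcP s _ (singleton-⊆ w∈s) Ps) (dcQ t _ (singleton-⊆ w∈t) Qt))
    (λ w∉⋃Q → _ , Equivalence.from (wi w) (λ Q[w] → w∉⋃Q (_ , Q[w] , ∈-singleton w)) , ∈-singleton w)

groundComplementaryModBotNE⇔groundComplementary : ∀ {P Q : TeamProp n} →
  EmptyTeamProperty P → EmptyTeamProperty Q → GroundComplementaryModBotNE P Q ⇔ GroundComplementary P Q
groundComplementaryModBotNE⇔groundComplementary etpP etpQ = mk⇔
  (λ where (inj₁ gc)        → gc
           (inj₂ (inj₁ P≡∅)) → contradiction (P≡∅ emptyTeam) (not-¬ etpP)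
           (inj₂ (inj₂ Q≡∅)) → contradiction (Q≡∅ emptyTeam) (not-¬ etpQ))
  inj₁

-- Finite enumerations

allVals : ∀ n → List (Val n)
allVals zero    = [ [] ]
allVals (suc n) = map (true ∷_) (allVals n) ++ map (false ∷_) (allVals n)

∈-allVals : ∀ (v : Val n) → v ∈ allVals n
∈-allVals []          = here refl
∈-allVals (true ∷ v)  = ∈-++⁺ˡ (∈-map⁺ (true ∷_) (∈-allVals v))
∈-allVals (false ∷ v) = ∈-++⁺ʳ (map (true ∷_) _) (∈-map⁺ (false ∷_) (∈-allVals v))

allVals-unique : ∀ n → Unique (allVals n)
allVals-unique zero    = [] ∷ []
allVals-unique (suc n) =
  Unique.++⁺ (Unique.map⁺ ∷-injectiveʳ (allVals-unique n)) (Unique.map⁺ ∷-injectiveʳ (allVals-unique n))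
    λ (v∈true∷ , v∈false∷) → case ∈-map⁻ (true ∷_) v∈true∷ , ∈-map⁻ (false ∷_) v∈false∷ of λ where
      ((_ , _ , refl) , (_ , _ , ()))

inhabited? : ∀ (t : Team n) → Dec (∃ λ v → v ∈ₜ t)
inhabited? {n} t = Dec.map′ (λ some → let (v , _ , v∈t) = find some in v , v∈t)
                            (λ (v , v∈t) → lose (∈-allVals v) v∈t)
                            (any? (λ v → t v Bool.≟ true) (allVals n))

elements : Team n → List (Val n)
elements {n} t = filter (λ v → t v Bool.≟ true) (allVals n)

∈-elements⁺ : v ∈ₜ t → v ∈ elements t
∈-elements⁺ {v = v} {t = t} = ∈-filter⁺ (λ v → t v Bool.≟ true) (∈-allVals v)

∈-elements⁻ : v ∈ elements t → v ∈ₜ t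
∈-elements⁻ {n} {t = t} = proj₂ ∘ ∈-filter⁻ (λ v → t v Bool.≟ true) {xs = allVals n}

elements-unique : ∀ (t : Team n) → Unique (elements t)
elements-unique {n} t = Unique.filter⁺ (λ v → t v Bool.≟ true) (allVals-unique n)

listTeam : List (Val n) → Team n
listTeam S v = does (any? (v ≟ᵥ_) S)

∈-listTeam⁺ : ∀ {S : List (Val n)} → v ∈ S → v ∈ₜ listTeam S
∈-listTeam⁺ {v = v} {S} = dec-true (any? (v ≟ᵥ_) S)

∈-listTeam⁻ : ∀ (S : List (Val n)) v → v ∈ₜ listTeam S → v ∈ S
∈-listTeam⁻ S v = does⇒ (any? (v ≟ᵥ_) S)

sublists : List A → List (List A)
sublists []       = [ [] ]
sublists (x ∷ xs) = map (x ∷_) (sublists xs) ++ sublists xs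

filter-∈-sublists : ∀ {P : A → Set} (P? : Decidable P) xs → filter P? xs ∈ sublists xs
filter-∈-sublists P? []       = here refl
filter-∈-sublists P? (x ∷ xs) with does (P? x)
... | true  = ∈-++⁺ˡ (∈-map⁺ (x ∷_) (filter-∈-sublists P? xs))
... | false = ∈-++⁺ʳ (map (x ∷_) (sublists xs)) (filter-∈-sublists P? xs)

∈-─⁺ : ∀ {a b : A} {xs} (a∈xs : a ∈ xs) → b ∈ xs → b ≢ a → b ∈ xs ─ a∈xs
∈-─⁺ (here refl)  (here refl)  b≢a = contradiction refl b≢a
∈-─⁺ (here _)     (there b∈xs) _   = b∈xs
∈-─⁺ (there _)    (here refl)  _   = here refl
∈-─⁺ (there a∈xs) (there b∈xs) b≢a = there (∈-─⁺ a∈xs b∈xs b≢a)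

unique-length-≤ : ∀ {xs ys : List A} → Unique xs → xs ⊆ ys → length xs ≤ length ys
unique-length-≤ {xs = []}     _                 _     = z≤n
unique-length-≤ {xs = x ∷ xs} {ys} (x∉xs ∷ xs!) x∷xs⊆ys =
  subst (_ ≤_) (sym (length-removeAt′ ys _))
        (s≤s (unique-length-≤ xs! λ y∈xs →
           ∈-─⁺ x∈ys (x∷xs⊆ys (there y∈xs)) (All.lookup x∉xs y∈xs ∘ sym)))
  where x∈ys = x∷xs⊆ys (here refl)

-- Flat formulas and cardinality formulas

⋁ : (A → Form n) → List A → Form n
⋁ F []       = bot
⋁ F (a ∷ as) = F a ∨' ⋁ F as

-- Encoded as a De Morgan dual, so that the support and anti-support of ⋀ F are, definitionally,
-- the anti-support and support of ⋁ (~_ ∘ F).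
⋀ : (A → Form n) → List A → Form n
⋀ F as = ~ ⋁ (~_ ∘ F) as

⊨⁻-⋁⁺ : ∀ (F : A → Form n) as → (∀ a → a ∈ as → t ⊨⁻ F a) → t ⊨⁻ ⋁ F as
⊨⁻-⋁⁺ F []       _ = tt
⊨⁻-⋁⁺ F (a ∷ as) h = h a (here refl) , ⊨⁻-⋁⁺ F as (λ b b∈as → h b (there b∈as))

⊨⁻-⋁⁻ : ∀ (F : A → Form n) as → t ⊨⁻ ⋁ F as → ∀ a → a ∈ as → t ⊨⁻ F a
⊨⁻-⋁⁻ F (a ∷ as) (ha , _)  a (here refl)  = ha
⊨⁻-⋁⁻ F (_ ∷ as) (_ , has) b (there b∈as) = ⊨⁻-⋁⁻ F as has b b∈as

⊨-⋁-cover : ∀ (F : A → Form n) (T : A → Team n) → (∀ a {u} → u ⊆ₜ T a → u ⊨ F a) →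
            ∀ as → (∀ v → v ∈ₜ t → Any (λ a → v ∈ₜ T a) as) → t ⊨ ⋁ F as
⊨-⋁-cover F T hF [] cover w = ¬-not (λ w∈t → case cover w w∈t of λ ())
⊨-⋁-cover {t = t} F T hF (a ∷ as) cover =
  t ∩ T a , t ∩ ∁ (T a) , ∩-∁-partition t (T a) , hF a (∩-⊆ʳ t (T a)) , ⊨-⋁-cover F T hF as cover′
  where
  cover′ : ∀ v → v ∈ₜ (t ∩ ∁ (T a)) → Any (λ b → v ∈ₜ T b) as
  cover′ v v∈t∖Ta with cover v (∩-⊆ˡ t (∁ (T a)) v v∈t∖Ta)
  ... | here v∈Ta = contradiction (∈-∁⁻ (T a) v (∩-⊆ʳ t (∁ (T a)) v v∈t∖Ta)) (not-¬ v∈Ta)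
  ... | there v∈⋃ = v∈⋃

⊨-⋁⁻ : ∀ (F : A → Form n) as → t ⊨ ⋁ F as → ∀ v → v ∈ₜ t → Any (λ a → singleton v ⊨ F a) as
⊨-⋁⁻ F []       t≡∅ v v∈t = contradiction (t≡∅ v) (not-¬ v∈t)
⊨-⋁⁻ F (a ∷ as) (b , c , t≡b∪c , hb , hc) v v∈t with ∈-∪⁻ b c t≡b∪c v v∈t
... | inj₁ v∈b = here (⊨-downward (F a) (singleton-⊆ v∈b) hb)
... | inj₂ v∈c = there (⊨-⋁⁻ F as hc v v∈c)

⊨-⋀⁺ : ∀ (F : A → Form n) as → (∀ a → a ∈ as → t ⊨ F a) → t ⊨ ⋀ F as
⊨-⋀⁺ F = ⊨⁻-⋁⁺ (~_ ∘ F)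

⊨-⋀⁻ : ∀ (F : A → Form n) as → t ⊨ ⋀ F as → ∀ a → a ∈ as → t ⊨ F a
⊨-⋀⁻ F = ⊨⁻-⋁⁻ (~_ ∘ F)

⊨⁻-⋀-cover : ∀ (F : A → Form n) (T : A → Team n) → (∀ a {u} → u ⊆ₜ T a → u ⊨⁻ F a) →
             ∀ as → (∀ v → v ∈ₜ t → Any (λ a → v ∈ₜ T a) as) → t ⊨⁻ ⋀ F as
⊨⁻-⋀-cover F = ⊨-⋁-cover (~_ ∘ F)

lit : Bool → Fin n → Form n
lit true  i = var i
lit false i = ~ var i

⊨-lit⁺ : ∀ b (i : Fin n) → (∀ v → v ∈ₜ t → lookup v i ≡ b) → t ⊨ lit b i
⊨-lit⁺ true  i h = h
⊨-lit⁺ false i h = h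

⊨-lit⁻ : ∀ b (i : Fin n) → t ⊨ lit b i → ∀ v → v ∈ₜ t → lookup v i ≡ b
⊨-lit⁻ true  i h = h
⊨-lit⁻ false i h = h

⊨⁻-lit⁺ : ∀ b (i : Fin n) → (∀ v → v ∈ₜ t → lookup v i ≡ not b) → t ⊨⁻ lit b i
⊨⁻-lit⁺ true  i h = h
⊨⁻-lit⁺ false i h = h

only : Val n → Form n
only {n} x = ⋀ (λ i → lit (lookup x i) i) (allFin n)

⊨-only⁺ : ∀ (x : Val n) → t ⊆ₜ singleton x → t ⊨ only x
⊨-only⁺ {n} x t⊆[x] = ⊨-⋀⁺ _ (allFin n) λ i _ →
  ⊨-lit⁺ (lookup x i) i (λ v v∈t → cong (λ y → lookup y i) (∈-singleton⁻ v x (t⊆[x] v v∈t)))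

⊨-only⁻ : ∀ (v x : Val n) → singleton v ⊨ only x → v ≡ x
⊨-only⁻ {n} v x h = Pointwise-≡⇒≡ (ext λ i →
  ⊨-lit⁻ (lookup x i) i (⊨-⋀⁻ _ (allFin n) h i (∈-allFin i)) v (∈-singleton v))

⊨⁻-only⁺ : ∀ (x : Val n) → x ∉ₜ t → t ⊨⁻ only x
⊨⁻-only⁺ {n} {t} x x∉t = ⊨⁻-⋀-cover _ differsAt
  (λ i u⊆ → ⊨⁻-lit⁺ (lookup x i) i (λ v v∈u → does⇒ (lookup v i Bool.≟ not (lookup x i)) (u⊆ v v∈u)))
  (allFin n) cover
  where
  differsAt : Fin n → Team n
  differsAt i v = does (lookup v i Bool.≟ not (lookup x i))

  cover : ∀ v → v ∈ₜ t → Any (λ i → v ∈ₜ differsAt i) (allFin n)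
  cover v v∈t with any? (λ i → lookup v i Bool.≟ not (lookup x i)) (allFin n)
  ... | yes differ = Any.map (dec-true (lookup v _ Bool.≟ _)) differ
  ... | no ¬differ = contradiction (subst (_∈ₜ t) v≡x v∈t) (not-¬ x∉t)
    where
    v≡x : v ≡ x
    v≡x = Pointwise-≡⇒≡ (ext λ i → trans (¬-not (¬differ ∘ lose (∈-allFin i))) (not-involutive _))

within : Team n → Form n
within a = ⋁ only (elements a)

⊨-within⁺ : t ⊆ₜ a → t ⊨ within a
⊨-within⁺ {a = a} t⊆a = ⊨-⋁-cover only singleton (λ x → ⊨-only⁺ x) (elements a) λ v v∈t →
  lose (∈-elements⁺ (t⊆a v v∈t)) (∈-singleton v)

⊨-within⁻ : t ⊨ within a → t ⊆ₜ a
⊨-within⁻ {a = a} h v v∈t =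
  let (x , x∈a , [v]⊨x) = find (⊨-⋁⁻ only (elements a) h v v∈t)
  in subst (_∈ₜ a) (sym (⊨-only⁻ v x [v]⊨x)) (∈-elements⁻ x∈a)

⊨⁻-within⁺ : (∀ v → v ∈ₜ t → v ∉ₜ a) → t ⊨⁻ within a
⊨⁻-within⁺ {a = a} t∩a≡∅ = ⊨⁻-⋁⁺ only (elements a) λ x x∈a →
  ⊨⁻-only⁺ x (¬-not λ x∈t → not-¬ (∈-elements⁻ x∈a) (t∩a≡∅ x x∈t))

⊨⁻-within⁻ : t ⊨⁻ within a → ∀ v → v ∈ₜ t → v ∉ₜ a
⊨⁻-within⁻ {a = a} h v v∈t = ¬-not λ v∈a →
  ⊨⁻⇒singleton-⊭ (within a) h v∈t (⊨-within⁺ {a = a} (singleton-⊆ v∈a))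

atMostOne : Form n
atMostOne {n} = ⋀ (dep []) (allFin n)

⊨-atMostOne⁺ : ∀ (x : Val n) → t ⊆ₜ singleton x → t ⊨ atMostOne
⊨-atMostOne⁺ {n} x t⊆[x] = ⊨-⋀⁺ (dep []) (allFin n) λ i _ u v u∈t v∈t _ →
  cong (λ y → lookup y i) (trans (∈-singleton⁻ u x (t⊆[x] u u∈t)) (sym (∈-singleton⁻ v x (t⊆[x] v v∈t))))

⊨-atMostOne⁻ : t ⊨ atMostOne → ∀ u v → u ∈ₜ t → v ∈ₜ t → u ≡ v
⊨-atMostOne⁻ {n} h u v u∈t v∈t =
  Pointwise-≡⇒≡ (ext λ i → ⊨-⋀⁻ (dep []) (allFin n) h i (∈-allFin i) u v u∈t v∈t [])

atMost : ℕ → Form n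
atMost zero    = bot
atMost (suc k) = atMostOne ∨' atMost k

atMost-length : ∀ (as : List A) → atMost {n} (length as) ≡ ⋁ (λ _ → atMostOne) as
atMost-length []       = refl
atMost-length (_ ∷ as) = cong (atMostOne ∨'_) (atMost-length as)

⊨-atMost⁺ : ∀ (vs : List (Val n)) → (∀ v → v ∈ₜ t → v ∈ vs) → t ⊨ atMost (length vs)
⊨-atMost⁺ {t = t} vs t⊆vs = subst (t ⊨_) (sym (atMost-length vs))
  (⊨-⋁-cover _ singleton (λ x → ⊨-atMostOne⁺ x) vs λ v v∈t →
     Any.map (λ { refl → ∈-singleton v }) (t⊆vs v v∈t))

⊨-atMost⁻ : ∀ k → t ⊨ atMost {n} k → ∃ λ vs → length vs ≤ k × (∀ v → v ∈ₜ t → v ∈ vs)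
⊨-atMost⁻ zero    t≡∅ = [] , z≤n , λ v v∈t → contradiction (t≡∅ v) (not-¬ v∈t)
⊨-atMost⁻ (suc k) (a , b , t≡a∪b , ha , hb) with ⊨-atMost⁻ k hb | inhabited? a
... | vs , |vs|≤k , b⊆vs | yes (x , x∈a) =
  x ∷ vs , s≤s |vs|≤k , λ v v∈t → [ (λ v∈a → here (⊨-atMostOne⁻ ha v x v∈a x∈a)) , (there ∘ b⊆vs v) ]′
                                    (∈-∪⁻ a b t≡a∪b v v∈t)
... | vs , |vs|≤k , b⊆vs | no a≡∅ =
  vs , m≤n⇒m≤1+n |vs|≤k , λ v v∈t → [ (λ v∈a → contradiction (v , v∈a) a≡∅) , b⊆vs v ]′
                                       (∈-∪⁻ a b t≡a∪b v v∈t)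

-- Expressive completeness for downward closed properties

-- For nonempty duplicate-free S, s ⊨ missesSomeOf S iff S ⊄ s.
missesSomeOf : List (Val n) → Form n
missesSomeOf S = atMost (pred (length S)) ∨' within (∁ (listTeam S))

⊨-missesSomeOf⁺ : ∀ (S : List (Val n)) → w ∈ S → w ∉ₜ s → s ⊨ missesSomeOf S
⊨-missesSomeOf⁺ {s = s} S w∈S w∉s =
  s ∩ listTeam S , s ∩ ∁ (listTeam S) , ∩-∁-partition s (listTeam S) , s∩S⊨atMost , s∖S⊨within
  where
  s∩S⊆S─w : ∀ v → v ∈ₜ (s ∩ listTeam S) → v ∈ S ─ w∈S
  s∩S⊆S─w v v∈s∩S = ∈-─⁺ w∈S (∈-listTeam⁻ S v (∩-⊆ʳ s (listTeam S) v v∈s∩S))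
                              (λ { refl → not-¬ (∩-⊆ˡ s (listTeam S) v v∈s∩S) w∉s })

  s∩S⊨atMost : (s ∩ listTeam S) ⊨ atMost (pred (length S))
  s∩S⊨atMost = subst (λ k → _ ⊨ atMost k) (length-removeAt S _) (⊨-atMost⁺ (S ─ w∈S) s∩S⊆S─w)

  s∖S⊨within : (s ∩ ∁ (listTeam S)) ⊨ within (∁ (listTeam S))
  s∖S⊨within = ⊨-within⁺ (∩-⊆ʳ s (∁ (listTeam S)))

⊨-missesSomeOf⁻ : ∀ (S : List (Val n)) → s ⊨ missesSomeOf S → Unique S → (∀ v → v ∈ S → v ∈ₜ s) → S ≡ []
⊨-missesSomeOf⁻ []        _                            _  _   = refl
⊨-missesSomeOf⁻ S@(_ ∷ _) (b , c , s≡b∪c , hb , hc) S! S⊆s with ⊨-atMost⁻ (pred (length S)) hb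
... | vs , |vs|<|S| , b⊆vs = contradiction (≤-trans (unique-length-≤ S! S⊆vs) |vs|<|S|) 1+n≰n
  where
  S⊆vs : S ⊆ vs
  S⊆vs {v} v∈S = b⊆vs v (∈-∪⁻ˡ b c s≡b∪c v (S⊆s v v∈S) λ v∈c →
    not-¬ (∈-listTeam⁺ v∈S) (∈-∁⁻ (listTeam S) v (⊨-within⁻ hc v v∈c)))

excluded : TeamProp n → List (List (Val n))
excluded {n} P = filter (λ S → P (listTeam S) Bool.≟ false) (sublists (allVals n))

characteristic : TeamProp n → Form n
characteristic P = ⋀ missesSomeOf (excluded P)

module _ {P : TeamProp n} (dcP : DownwardClosed P) where

  characteristic-sound : P s ≡ true → s ⊨ characteristic P
  characteristic-sound {s} Ps = ⊨-⋀⁺ missesSomeOf (excluded P) λ S S∈excluded →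
    case any? (λ v → s v Bool.≟ false) S of λ where
      (yes missing) → let (w , w∈S , w∉s) = find missing in ⊨-missesSomeOf⁺ S w∈S w∉s
      (no ¬missing) → contradiction (proj₂ (∈-filter⁻ _ {xs = sublists (allVals n)} S∈excluded))
        (not-¬ (dcP s (listTeam S) (λ v v∈S → ¬-not (¬missing ∘ lose (∈-listTeam⁻ S v v∈S))) Ps))

  characteristic-complete : EmptyTeamProperty P → s ⊨ characteristic P → P s ≡ true
  characteristic-complete {s} etpP h with P (listTeam (elements s)) in P[s]
  ... | true  = dcP _ s (λ v v∈s → ∈-listTeam⁺ (∈-elements⁺ {t = s} v∈s)) P[s]
  ... | false = dcP emptyTeam s s⊆∅ etpP
    where
    elements≡[] : elements s ≡ []
    elements≡[] = ⊨-missesSomeOf⁻ (elements s)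
      (⊨-⋀⁻ missesSomeOf (excluded P) h _ (∈-filter⁺ _ (filter-∈-sublists _ (allVals n)) P[s]))
      (elements-unique s) (λ v → ∈-elements⁻)

    s⊆∅ : s ⊆ₜ emptyTeam
    s⊆∅ v v∈s = case subst (v ∈_) elements≡[] (∈-elements⁺ v∈s) of λ ()

  characteristic-expresses : EmptyTeamProperty P → Expresses (characteristic P) P
  characteristic-expresses etpP s = mk⇔ (characteristic-complete etpP) characteristic-sound

-- Bicompleteness

⊨⁻-characteristic⁻ : ∀ {P : TeamProp n} → DownwardClosed P → t ⊨⁻ characteristic P →
                     ∀ v → v ∈ₜ t → P (singleton v) ≡ false
⊨⁻-characteristic⁻ {P = P} dcP h v v∈t =
  ¬-not λ P[v] → ⊨⁻⇒singleton-⊭ (characteristic P) h v∈t (characteristic-sound dcP P[v])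

-- For downward closed P, ground P is ⋃P.
ground : TeamProp n → Team n
ground P w = P (singleton w)

pairFormula : TeamProp n → TeamProp n → Form n
pairFormula P Q = (characteristic P ∧' within (ground P)) ∨' (~ (characteristic Q ∨' within (ground P)))

module _ {P Q : TeamProp n} (dcP : DownwardClosed P) (etpP : EmptyTeamProperty P)
         (dcQ : DownwardClosed Q) (etpQ : EmptyTeamProperty Q) (wi : WorldIncompatible P Q) where

  private
    αP αQ : Form n
    αP = characteristic P
    αQ = characteristic Q

  pairFormula-support : Expresses (pairFormula P Q) P
  pairFormula-support s = mk⇔
    (λ (t , u , s≡t∪u , (t⊨αP , _) , (u⊨⁻αQ , u⊨⁻P₀)) →
      dcP t s (λ v v∈s → ∈-∪⁻ˡ t u s≡t∪u v v∈s λ v∈u →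
                not-¬ (Equivalence.from (wi v) λ Q[v] → not-¬ Q[v] (⊨⁻-characteristic⁻ dcQ u⊨⁻αQ v v∈u))
                      (⊨⁻-within⁻ {a = ground P} u⊨⁻P₀ v v∈u))
              (characteristic-complete dcP etpP t⊨αP))
    (λ Ps → ⊨-∨-introˡ (αP ∧' within (ground P)) (~ (αQ ∨' within (ground P)))
              (characteristic-sound dcP Ps ,
               ⊨-within⁺ λ v v∈s → dcP s (singleton v) (singleton-⊆ v∈s) Ps))

  pairFormula-antiSupport : Expresses (~ pairFormula P Q) Q
  pairFormula-antiSupport s = mk⇔
    (λ ((c , d , s≡c∪d , c⊨⁻αP , d⊨⁻P₀) , (a , b , s≡a∪b , a⊨αQ , b⊨P₀)) →
      let s∩P₀≡∅ : ∀ v → v ∈ₜ s → v ∉ₜ ground P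
          s∩P₀≡∅ v v∈s = [ ⊨⁻-characteristic⁻ dcP c⊨⁻αP v , ⊨⁻-within⁻ {a = ground P} d⊨⁻P₀ v ]′
                            (∈-∪⁻ c d s≡c∪d v v∈s)
      in dcQ a s (λ v v∈s → ∈-∪⁻ˡ a b s≡a∪b v v∈s λ v∈b →
                   not-¬ (⊨-within⁻ {a = ground P} b⊨P₀ v v∈b) (s∩P₀≡∅ v v∈s))
             (characteristic-complete dcQ etpQ a⊨αQ))
    (λ Qs → ⊨⁻-∧-introʳ αP (within (ground P))
              (⊨⁻-within⁺ λ v v∈s → ¬-not λ P[v] →
                 Equivalence.to (wi v) P[v] (dcQ s (singleton v) (singleton-⊆ v∈s) Qs)) ,
            ⊨-∨-introˡ αQ (within (ground P)) (characteristic-sound dcQ Qs))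

bicomplete-worldIncompatible : Bicomplete (DCE WorldIncompatible)
bicomplete-worldIncompatible n P Q = mk⇔
  (λ (φ , φ≡PQ) → expressesPair⇒DCE φ φ≡PQ)
  (λ (dcP , etpP , dcQ , etpQ , wi) →
     pairFormula P Q , pairFormula-support dcP etpP dcQ etpQ wi ,
                       pairFormula-antiSupport dcP etpP dcQ etpQ wi)

Condition : Set₁
Condition = ∀ {n} → TeamProp n → TeamProp n → Set

bicomplete-cong : ∀ {C C′ : Condition} →
  (∀ {n} {P Q : TeamProp n} → DownwardClosed P → EmptyTeamProperty P →
                               DownwardClosed Q → EmptyTeamProperty Q → C P Q ⇔ C′ P Q) →
  Bicomplete (DCE C′) → Bicomplete (DCE C)
bicomplete-cong C⇔C′ bc n P Q = ⇔.trans (bc n P Q) (mk⇔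
  (λ (dcP , etpP , dcQ , etpQ , c′) → dcP , etpP , dcQ , etpQ ,
                                      Equivalence.from (C⇔C′ dcP etpP dcQ etpQ) c′)
  (λ (dcP , etpP , dcQ , etpQ , c)  → dcP , etpP , dcQ , etpQ ,
                                      Equivalence.to (C⇔C′ dcP etpP dcQ etpQ) c))

bicomplete⇒bicompleteModExpr : ∀ {C : Condition} → Bicomplete (DCE C) → BicompleteModExpr C
bicomplete⇒bicompleteModExpr bc n P Q (φ , φ≡P) (ψ , ψ≡Q) = ⇔.trans (bc n P Q) (mk⇔
  (λ (_ , _ , _ , _ , c) → c)
  (λ c → expresses⇒downwardClosed φ φ≡P , expresses⇒emptyTeamProperty φ φ≡P ,
         expresses⇒downwardClosed ψ ψ≡Q , expresses⇒emptyTeamProperty ψ ψ≡Q , c))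

corollary3p34 : (Bicomplete (DCE GroundComplementary)
                  × Bicomplete (DCE GroundComplementaryModBotNE)
                  × Bicomplete (DCE WorldIncompatible))
                × (BicompleteModExpr GroundComplementary
                  × BicompleteModExpr GroundComplementaryModBotNE
                  × BicompleteModExpr WorldIncompatible)
corollary3p34 =
  (bc-GC , bc-GC-BotNE , bc-WI) ,
  (bicomplete⇒bicompleteModExpr bc-GC ,
   bicomplete⇒bicompleteModExpr bc-GC-BotNE ,
   bicomplete⇒bicompleteModExpr bc-WI)
  where
  bc-WI : Bicomplete (DCE WorldIncompatible)
  bc-WI = bicomplete-worldIncompatible

  bc-GC : Bicomplete (DCE GroundComplementary)
  bc-GC = bicomplete-cong (λ dcP _ dcQ _ → groundComplementary⇔worldIncompatible dcP dcQ) bc-WI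

  bc-GC-BotNE : Bicomplete (DCE GroundComplementaryModBotNE)
  bc-GC-BotNE = bicomplete-cong
    (λ _ etpP _ etpQ → groundComplementaryModBotNE⇔groundComplementary etpP etpQ) bc-GC
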